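{- Let $k,l\ge1$. Let $u=u_1\cdots u_l$ be a word of length $l$ that is a factor of $f_\infty^{b,a}$ or of $f_\infty^{d,c}$, and let $v=v_1\cdots v_k$ be a word of length $k$ that is a factor of $f_\infty^{c,a}$ or of $f_\infty^{d,b}$, with $u_1=v_1$. Let $\theta$ be the substitution $\theta(a)=c,\theta(b)=d$ if $u$ is over $\{a,b\}$, and $\theta(c)=a,\theta(d)=b$ if $u$ is over $\{c,d\}$. Then the $k\times l$ array whose first row is $u$ and whose $r$-th row ($2\le r\le k$) is $u$ if $v_r=v_1$ and $\theta(u)$ otherwise, is a factor of $f_{\infty,\infty}$ of size $(k,l)$; its first row is $u$ and its first column is $v$.
   Context: For letters $s_1,s_2$, $f_\infty^{s_1,s_2}=s_1s_2s_1s_1s_2s_1s_2s_1\cdots$ denotes the infinite Fibonacci word over $\{s_1,s_2\}$, i.e. the image of $x=101101011\cdots$ (fixed point of $1\mapsto10,0\mapsto1$) under $1\mapsto s_1,0\mapsto s_2$. The $2D$ infinite Fibonacci word $f_{\infty,\infty}=[f(i,j)]_{i,j\ge1}$ is the fixed point $\lim_{n}\mu^n(d)$ of the $2D$ morphism $d\mapsto\begin{smallmatrix}d&c\\ b&a\end{smallmatrix}$, $c\mapsto\begin{smallmatrix}d\\ b\end{smallmatrix}$, $b\mapsto\begin{smallmatrix}d&c\end{smallmatrix}$, $a\mapsto d$; equivalently $f(i,j)=d,c,b,a$ according as $(x_i,x_j)=(1,1),(1,0),(0,1),(0,0)$. A factor of size $(k,l)$ is a $k\times l$ block of $f_{\infty,\infty}$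 occupying rows $i+1,\dots,i+k$ and columns $j+1,\dots,j+l$ for some $i,j\ge0$. -}

module Defs where

open import Data.Nat using (ℕ; zero; suc; _+_)
open import Data.Bool using (Bool; true; false)
open import Data.List using (List; []; _∷_)
open import Relation.Binary.PropositionalEquality using (_≡_; refl)
open import Relation.Nullary using (Dec; yes; no)

data Letter : Set where
  a b c d : Letter

_≟L_ : (x y : Letter) → Dec (x ≡ y)
a ≟L a = yes refl
a ≟L b = no (λ ())
a ≟L c = no (λ ())
a ≟L d = no (λ ())
b ≟L a = no (λ ())
b ≟L b = yes refl
b ≟L c = no (λ ())
b ≟L d = no (λ ())
c ≟L a = no (λ ())
c ≟L b = no (λ ())
c ≟L c = yes refl
c ≟L d = no (λ ())
d ≟L a = no (λ ())
d ≟L b = no (λ ())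
d ≟L c = no (λ ())
d ≟L d = yes refl

-- Fibonacci morphism 1 ↦ 10, 0 ↦ 1 on words over Bool (true = 1, false = 0).
fibMorph : List Bool → List Bool
fibMorph [] = []
fibMorph (true ∷ w) = true ∷ false ∷ fibMorph w
fibMorph (false ∷ w) = true ∷ fibMorph w

fibIter : ℕ → List Bool
fibIter zero = true ∷ []
fibIter (suc n) = fibMorph (fibIter n)

-- n-th letter (0-indexed) of a list, with default false
nth : List Bool → ℕ → Bool
nth [] _ = false
nth (y ∷ ys) zero = y
nth (y ∷ ys) (suc n) = nth ys n

-- fibX n = x_{n+1}, the (n+1)-th letter of the infinite Fibonacci word
-- x = 101101011... ; μ^(n+1)(1) has length ≥ n+2, and is a prefix of x.
fibX : ℕ → Bool
fibX n = nth (fibIter (suc n)) n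

img : Letter → Letter → Bool → Letter
img s₁ s₂ true = s₁
img s₁ s₂ false = s₂

-- fibWord s₁ s₂ n = (n+1)-th letter of f_∞^{s₁,s₂}
fibWord : Letter → Letter → ℕ → Letter
fibWord s₁ s₂ n = img s₁ s₂ (fibX n)

-- fib2D i j = f(i+1, j+1), entry of the 2D infinite Fibonacci word
fib2D : ℕ → ℕ → Letter
fib2D i j with fibX i | fibX j
... | true  | true  = d
... | true  | false = c
... | false | true  = b
... | false | false = a

IsFactorOf : Letter → Letter → (l : ℕ) → (ℕ → Letter) → Set
IsFactorOf s₁ s₂ l w = Σ' where
  open import Data.Product using (∃)
  open import Data.Nat using (_<_)
  Σ' : Set
  Σ' = ∃ λ p → ∀ t → t < l → w t ≡ fibWord s₁ s₂ (p + t)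

-- θ: a ↦ c, b ↦ d (used when u is over {a,b}); c ↦ a, d ↦ b (when u is over {c,d}).
θ : Letter → Letter
θ a = c
θ b = d
θ c = a
θ d = b

array : (ℕ → Letter) → (ℕ → Letter) → ℕ → ℕ → Letter
array u v r t with v r ≟L v 0
... | yes _ = u t
... | no  _ = θ (u t)

{-# OPTIONS --safe #-}
module Submission where

open import Defs
open import Data.Nat using (ℕ; _+_; _<_; _≤_)
open import Data.Bool using (Bool; true; false; not)
open import Data.Bool.Properties using (¬-not)
open import Data.Product using (∃₂; _×_; _,_; proj₁; proj₂)
open import Data.Sum using (_⊎_; inj₁; inj₂)
open import Relation.Binary.PropositionalEquality using (_≡_; refl; sym; trans; cong)
open import Relation.Nullary using (yes; no; contradiction)

-- f(i,j) depends only on the pair (x_i, x_j): the rows of f_∞,∞ are f_∞^{d,c} (x_i = 1) and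
-- f_∞^{b,a} (x_i = 0), its columns f_∞^{d,b} and f_∞^{c,a}, and θ exchanges the two kinds of
-- row. A factor u of a row word and a factor v of a column word therefore fix the columns and
-- the rows of a block, and u₁ = v₁ makes them meet consistently in its corner; row r of that
-- block is then u or θ(u) according as x_{q+r} = x_q, i.e. as v_r = v_1.

cell : Bool → Bool → Letter
cell true  = img d c
cell false = img b a

fib2D-cell : ∀ i j → fib2D i j ≡ cell (fibX i) (fibX j)
fib2D-cell i j with fibX i | fibX j
... | true  | true  = refl
... | true  | false = refl
... | false | true  = refl
... | false | false = refl

img-row : ∀ ρ y → img (cell ρ true) (cell ρ false) y ≡ cell ρ y
img-row true  y = refl
img-row false y = refl

img-column : ∀ κ x → img (cell true κ) (cell false κ) x ≡ cell x κ
img-column κ true  = refl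
img-column κ false = refl

rowBit : Letter → Bool
rowBit a = false
rowBit b = false
rowBit c = true
rowBit d = true

columnBit : Letter → Bool
columnBit a = false
columnBit b = true
columnBit c = false
columnBit d = true

rowBit-cell : ∀ x y → rowBit (cell x y) ≡ x
rowBit-cell true  true  = refl
rowBit-cell true  false = refl
rowBit-cell false true  = refl
rowBit-cell false false = refl

columnBit-cell : ∀ x y → columnBit (cell x y) ≡ y
columnBit-cell true  true  = refl
columnBit-cell true  false = refl
columnBit-cell false true  = refl
columnBit-cell false false = refl

cell-injective : ∀ {x x′ y y′} → cell x y ≡ cell x′ y′ → x ≡ x′ × y ≡ y′
cell-injective {x} {x′} {y} {y′} eq =
  trans (sym (rowBit-cell x y)) (trans (cong rowBit eq) (rowBit-cell x′ y′)) ,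
  trans (sym (columnBit-cell x y)) (trans (cong columnBit eq) (columnBit-cell x′ y′))

θ-cell : ∀ x y → θ (cell x y) ≡ cell (not x) y
θ-cell true  true  = refl
θ-cell true  false = refl
θ-cell false true  = refl
θ-cell false false = refl

array-first-row : ∀ u v t → array u v 0 t ≡ u t
array-first-row u v t with v 0 ≟L v 0
... | yes _   = refl
... | no  v₀≢ = contradiction refl v₀≢

array-cell : ∀ u v r t {x x₀ y κ} → v r ≡ cell x κ → v 0 ≡ cell x₀ κ → u t ≡ cell x₀ y
  → array u v r t ≡ cell x y
array-cell u v r t {x} {x₀} {y} vr v₀ ut with v r ≟L v 0
... | yes vr≡v₀ = trans ut (cong (λ z → cell z y) (sym x≡x₀))
  where
  x≡x₀ : x ≡ x₀
  x≡x₀ = proj₁ (cell-injective (trans (sym vr) (trans vr≡v₀ v₀)))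
... | no  vr≢v₀ = trans (cong θ ut) (trans (θ-cell x₀ y) (cong (λ z → cell z y) (sym x≡¬x₀)))
  where
  x≡¬x₀ : x ≡ not x₀
  x≡¬x₀ = ¬-not (λ x≡x₀ → vr≢v₀ (trans vr (trans (cong (λ z → cell z _) x≡x₀) (sym v₀))))

-- ρ and κ are the bits x_i and x_j shared by the row word containing u and the column word
-- containing v; the occurrences of v and u give the block's top-left corner (i, j) = (q, p).
block : (k l : ℕ) → 1 ≤ k → 1 ≤ l → (u v : ℕ → Letter) → (ρ κ : Bool)
  → IsFactorOf (cell ρ true) (cell ρ false) l u
  → IsFactorOf (cell true κ) (cell false κ) k v
  → u 0 ≡ v 0
  → (∃₂ λ i j → ∀ r t → r < k → t < l → array u v r t ≡ fib2D (i + r) (j + t))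
    × (∀ t → t < l → array u v 0 t ≡ u t)
    × (∀ r → r < k → array u v r 0 ≡ v r)
block k l 1≤k 1≤l u v ρ κ (p , u≡) (q , v≡) u₀≡v₀ =
  (q , p , λ r t r<k t<l → trans (entry r t r<k t<l) (sym (fib2D-cell (q + r) (p + t))))
  , (λ t _ → array-first-row u v t)
  , λ r r<k → trans (entry r 0 r<k 1≤l)
                (trans (cong (cell (fibX (q + r))) p₀≡κ) (sym (vᵣ r r<k)))
  where
  uₜ : ∀ t → t < l → u t ≡ cell ρ (fibX (p + t))
  uₜ t t<l = trans (u≡ t t<l) (img-row ρ (fibX (p + t)))

  vᵣ : ∀ r → r < k → v r ≡ cell (fibX (q + r)) κ
  vᵣ r r<k = trans (v≡ r r<k) (img-column κ (fibX (q + r)))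

  corner : ρ ≡ fibX (q + 0) × fibX (p + 0) ≡ κ
  corner = cell-injective (trans (sym (uₜ 0 1≤l)) (trans u₀≡v₀ (vᵣ 0 1≤k)))

  p₀≡κ : fibX (p + 0) ≡ κ
  p₀≡κ = proj₂ corner

  entry : ∀ r t → r < k → t < l → array u v r t ≡ cell (fibX (q + r)) (fibX (p + t))
  entry r t r<k t<l = array-cell u v r t {fibX (q + r)} {fibX (q + 0)} (vᵣ r r<k) (vᵣ 0 1≤k)
    (trans (uₜ t t<l) (cong (λ z → cell z (fibX (p + t))) (proj₁ corner)))

mainTheorem3 : (k l : ℕ) → 1 ≤ k → 1 ≤ l → (u v : ℕ → Letter)
    → (IsFactorOf b a l u ⊎ IsFactorOf d c l u)
    → (IsFactorOf c a k v ⊎ IsFactorOf d b k v)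
    → u 0 ≡ v 0
    → (∃₂ λ i j → ∀ r t → r < k → t < l → array u v r t ≡ fib2D (i + r) (j + t))
    × (∀ t → t < l → array u v 0 t ≡ u t)
    × (∀ r → r < k → array u v r 0 ≡ v r)
mainTheorem3 k l 1≤k 1≤l u v (inj₁ uba) (inj₁ vca) = block k l 1≤k 1≤l u v false false uba vca
mainTheorem3 k l 1≤k 1≤l u v (inj₁ uba) (inj₂ vdb) = block k l 1≤k 1≤l u v false true  uba vdb
mainTheorem3 k l 1≤k 1≤l u v (inj₂ udc) (inj₁ vca) = block k l 1≤k 1≤l u v true  false udc vca
mainTheorem3 k l 1≤k 1≤l u v (inj₂ udc) (inj₂ vdb) = block k l 1≤k 1≤l u v true  true  udc vdb
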